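{- Let $\mathcal{H}\subseteq\mathcal{P}(X)$ be a family of subsets of a set $X$ and let $\mathcal{H}\mathbin{\triangle\!\!\!\bigcirc}\mathcal{H}=\{H_1\triangle H_2:H_1,H_2\in\mathcal{H}\}$. Then $\mathrm{VC}(\mathcal{H}\mathbin{\triangle\!\!\!\bigcirc}\mathcal{H})\le C\cdot\mathrm{VC}(\mathcal{H})$, where $C=\max\{c\ge1: h_2(1/c)\le 1/2\}\le 9.09$ and $h_2(p)=p\log_2\frac1p+(1-p)\log_2\frac1{1-p}$.
   Context: A family $\mathcal{G}\subseteq\mathcal{P}(X)$ shatters a set $U$ if $\{G\cap U:G\in\mathcal{G}\}=\mathcal{P}(U)$; $\mathrm{VC}(\mathcal{G})$ is the supremum of $|U|$ over finite sets $U$ shattered by $\mathcal{G}$ (possibly $\infty$). -}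

module Defs where

open import Data.Bool using (Bool; _xor_)
open import Data.Nat using (ℕ; _≤_; _*_; _^_; _∸_)
open import Data.Sum using (_⊎_)
open import Data.Product using (∃; _×_; Σ-syntax)
open import Data.Fin using (Fin)
open import Data.Fin.Subset using (Subset)
open import Data.Vec using (lookup)
open import Function.Definitions using (Injective)
open import Relation.Binary.PropositionalEquality using (_≡_)

Pow : Set → Set
Pow X = X → Bool

Family : Set → Set₁
Family X = Pow X → Set

-- A finite subset U ⊆ X with |U| = n: an injective enumeration Fin n → X.
record FinSub (X : Set) (n : ℕ) : Set where
  field
    elt : Fin n → X
    inj : Injective _≡_ _≡_ elt
open FinSub public

Shatters : {X : Set} → Family X → {n : ℕ} → FinSub X n → Set
Shatters 𝒢 {n} U =
  (S : Subset n) → ∃ λ G → 𝒢 G × (∀ i → G (elt U i) ≡ lookup S i)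

VC≤ : {X : Set} → Family X → ℕ → Set
VC≤ {X} 𝒢 d = ∀ {n} (U : FinSub X n) → Shatters 𝒢 U → n ≤ d

_△_ : {X : Set} → Pow X → Pow X → Pow X
(A △ B) x = A x xor B x

SymDiffFamily : {X : Set} → Family X → Family X
SymDiffFamily 𝓗 G = Σ[ H₁ ∈ _ ] Σ[ H₂ ∈ _ ] (𝓗 H₁ × 𝓗 H₂ × G ≡ H₁ △ H₂)

-- m ≤ C · d, where C = max{c ≥ 1 : h₂(1/c) ≥ 1/2} ≈ 9.09.
-- For naturals m, d this is equivalent to:
--   m ≤ 2d, or  h₂(d/m) ≥ 1/2, i.e.  2^m · d^(2d) · (m−d)^(2(m−d)) ≤ m^(2m).
LeC : ℕ → ℕ → Set
LeC m d = (m ≤ 2 * d) ⊎ ((2 ^ m) * (d ^ (2 * d)) * ((m ∸ d) ^ (2 * (m ∸ d))) ≤ m ^ (2 * m))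

-- Fix, for every S ⊆ U, members H₁, H₂ of 𝓗 with (H₁ △ H₂) ∩ U = S, and let T ⊆ {0,1}ᵐ be the
-- set of their traces on U. Every S ⊆ U is then a ⊕ b with a, b ∈ T, so 2ᵐ ≤ |T|². A set shattered
-- by T is shattered by 𝓗, hence has size ≤ d, and the Sauer–Shelah lemma gives
-- |T| ≤ Φ(m, d + 1) = Σ_{i≤d} (m choose i). For 2d < m the binomial theorem yields the entropy bound
-- Φ(m, d + 1) · dᵈ (m − d)^(m−d) ≤ mᵐ, and squaring it gives 2ᵐ d^(2d) (m − d)^(2(m−d)) ≤ m^(2m).
{-# OPTIONS --safe #-}
module Submission where

open import Defs
open import Data.Bool using (Bool; true; false; T; _∧_; _∨_; _xor_)
open import Data.Bool.Properties using (T-∧; T-∨; xor-assoc; xor-same) renaming (_≟_ to _≟ᵇ_)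
open import Data.Empty using (⊥-elim)
open import Data.Fin using (Fin; zero; suc)
open import Data.Fin.Properties using () renaming (suc-injective to fsuc-injective)
open import Data.Fin.Subset using (Subset; _∈_; ∣_∣; ⊥)
open import Data.Fin.Subset.Properties using (∉⊥)
open import Data.Nat using (ℕ; zero; suc; _+_; _*_; _^_; _∸_; _≤_; _<_; z≤n; s≤s; NonZero; >-nonZero; s<s⁻¹)
open import Data.Nat.Properties
open import Data.Nat.Tactic.RingSolver using (solve-∀)
open import Data.Product using (∃; _×_; _,_; proj₁; proj₂)
open import Data.Sum using (inj₁; inj₂; [_,_]′)
open import Data.Vec using ([]; _∷_; here; there; lookup; tabulate; zipWith)
open import Data.Vec.Properties using (lookup∘tabulate; lookup-zipWith; tabulate∘lookup; tabulate-cong; ≡-dec)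
open import Function using (_∘_; Equivalence)
open import Relation.Binary.Definitions using (DecidableEquality)
open import Relation.Binary.PropositionalEquality
open import Relation.Nullary using (yes; no; contradiction)
open import Relation.Nullary.Decidable using (⌊_⌋; toWitness; fromWitness)

open import Algebra.Properties.CommutativeSemigroup +-commutativeSemigroup using (interchange)
open Equivalence using (to; from)

-- Counting on the Boolean cube

iverson : Bool → ℕ
iverson false = 0
iverson true  = 1

sum : ∀ {m} → (Subset m → ℕ) → ℕ
sum {zero}  F = F []
sum {suc m} F = sum (F ∘ (false ∷_)) + sum (F ∘ (true ∷_))

count : ∀ {m} → (Subset m → Bool) → ℕ
count f = sum (iverson ∘ f)

any : ∀ {m} → (Subset m → Bool) → Bool
any {zero}  f = f []
any {suc m} f = any (f ∘ (false ∷_)) ∨ any (f ∘ (true ∷_))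

_⊕_ : ∀ {m} → Subset m → Subset m → Subset m
_⊕_ = zipWith _xor_

sum-cong : ∀ {m} {F G : Subset m → ℕ} → (∀ v → F v ≡ G v) → sum F ≡ sum G
sum-cong {zero}  F≗G = F≗G []
sum-cong {suc m} F≗G = cong₂ _+_ (sum-cong (F≗G ∘ (false ∷_))) (sum-cong (F≗G ∘ (true ∷_)))

sum-mono-≤ : ∀ {m} {F G : Subset m → ℕ} → (∀ v → F v ≤ G v) → sum F ≤ sum G
sum-mono-≤ {zero}  F≤G = F≤G []
sum-mono-≤ {suc m} F≤G = +-mono-≤ (sum-mono-≤ (F≤G ∘ (false ∷_))) (sum-mono-≤ (F≤G ∘ (true ∷_)))

sum-+ : ∀ {m} (F G : Subset m → ℕ) → sum F + sum G ≡ sum (λ v → F v + G v)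
sum-+ {zero}  F G = refl
sum-+ {suc m} F G = trans
  (interchange (sum (F ∘ (false ∷_))) (sum (F ∘ (true ∷_))) (sum (G ∘ (false ∷_))) (sum (G ∘ (true ∷_))))
  (cong₂ _+_ (sum-+ (F ∘ (false ∷_)) (G ∘ (false ∷_))) (sum-+ (F ∘ (true ∷_)) (G ∘ (true ∷_))))

sum-*ʳ : ∀ {m} (F : Subset m → ℕ) c → sum F * c ≡ sum (λ v → F v * c)
sum-*ʳ {zero}  F c = refl
sum-*ʳ {suc m} F c = trans (*-distribʳ-+ c (sum (F ∘ (false ∷_))) (sum (F ∘ (true ∷_))))
  (cong₂ _+_ (sum-*ʳ (F ∘ (false ∷_)) c) (sum-*ʳ (F ∘ (true ∷_)) c))

sum-⊕ : ∀ {m} (F : Subset m → ℕ) a → sum (λ v → F (a ⊕ v)) ≡ sum F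
sum-⊕ {zero}  F []          = refl
sum-⊕ {suc m} F (false ∷ a) = cong₂ _+_ (sum-⊕ (F ∘ (false ∷_)) a) (sum-⊕ (F ∘ (true ∷_)) a)
sum-⊕ {suc m} F (true ∷ a)  = trans (cong₂ _+_ (sum-⊕ (F ∘ (true ∷_)) a) (sum-⊕ (F ∘ (false ∷_)) a))
  (+-comm (sum (F ∘ (true ∷_))) (sum (F ∘ (false ∷_))))

iverson-mono : ∀ {a b} → (T a → T b) → iverson a ≤ iverson b
iverson-mono {false}         _   = z≤n
iverson-mono {true}  {true}  _   = ≤-refl
iverson-mono {true}  {false} a⇒b = ⊥-elim (a⇒b _)

iverson-∨+iverson-∧ : ∀ a b → iverson a + iverson b ≡ iverson (a ∨ b) + iverson (a ∧ b)
iverson-∨+iverson-∧ false false = refl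
iverson-∨+iverson-∧ false true  = refl
iverson-∨+iverson-∧ true  false = refl
iverson-∨+iverson-∧ true  true  = refl

iverson≤1 : ∀ b → iverson b ≤ 1
iverson≤1 false = z≤n
iverson≤1 true  = ≤-refl

count-true : ∀ {m} → count {m} (λ _ → true) ≡ 2 ^ m
count-true {zero}  = refl
count-true {suc m} = cong₂ _+_ (count-true {m}) (trans (count-true {m}) (sym (+-identityʳ _)))

count-false : ∀ {m} → count {m} (λ _ → false) ≡ 0
count-false {zero}  = refl
count-false {suc m} = cong₂ _+_ (count-false {m}) (count-false {m})

count-mono : ∀ {m} {f g : Subset m → Bool} → (∀ {v} → T (f v) → T (g v)) → count f ≤ count g
count-mono {m} f⊆g = sum-mono-≤ {m} (λ v → iverson-mono f⊆g)

count-∧ˡ : ∀ {m} b (f : Subset m → Bool) → count (λ v → b ∧ f v) ≡ iverson b * count f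
count-∧ˡ {m} false f = count-false {m}
count-∧ˡ     true  f = sym (+-identityʳ (count f))

count-∨+count-∧ : ∀ {m} (f g : Subset m → Bool) →
  count f + count g ≡ count (λ v → f v ∨ g v) + count (λ v → f v ∧ g v)
count-∨+count-∧ f g = begin
  count f + count g                                             ≡⟨ sum-+ (iverson ∘ f) (iverson ∘ g) ⟩
  sum (λ v → iverson (f v) + iverson (g v))                     ≡⟨ sum-cong (λ v → iverson-∨+iverson-∧ (f v) (g v)) ⟩
  sum (λ v → iverson (f v ∨ g v) + iverson (f v ∧ g v))         ≡⟨ sum-+ (iverson ∘ (λ v → f v ∨ g v)) (iverson ∘ (λ v → f v ∧ g v)) ⟨
  count (λ v → f v ∨ g v) + count (λ v → f v ∧ g v)             ∎
  where open ≡-Reasoning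

count-∨ : ∀ {m} (f g : Subset m → Bool) → count (λ v → f v ∨ g v) ≤ count f + count g
count-∨ f g = subst (count (λ v → f v ∨ g v) ≤_) (sym (count-∨+count-∧ f g)) (m≤m+n _ _)

count-any : ∀ {n m} (h : Subset n → Subset m → Bool) →
  count (λ v → any (λ a → h a v)) ≤ sum (λ a → count (h a))
count-any {zero}  h = ≤-refl
count-any {suc n} h = ≤-trans
  (count-∨ (λ v → any (λ a → h (false ∷ a) v)) (λ v → any (λ a → h (true ∷ a) v)))
  (+-mono-≤ (count-any (h ∘ (false ∷_))) (count-any (h ∘ (true ∷_))))

any-intro : ∀ {m} (f : Subset m → Bool) a → T (f a) → T (any f)
any-intro {zero}  f []          fa = fa
any-intro {suc m} f (false ∷ a) fa = from T-∨ (inj₁ (any-intro (f ∘ (false ∷_)) a fa))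
any-intro {suc m} f (true ∷ a)  fa = from T-∨ (inj₂ (any-intro (f ∘ (true ∷_)) a fa))

any-elim : ∀ {m} (f : Subset m → Bool) → T (any f) → ∃ λ a → T (f a)
any-elim {zero}  f t = [] , t
any-elim {suc m} f t with to T-∨ t
... | inj₁ t₀ = let a , fa = any-elim (f ∘ (false ∷_)) t₀ in false ∷ a , fa
... | inj₂ t₁ = let a , fa = any-elim (f ∘ (true ∷_)) t₁ in true ∷ a , fa

_≟ˢ_ : ∀ {m} → DecidableEquality (Subset m)
_≟ˢ_ = ≡-dec _≟ᵇ_

image : ∀ {n m} → (Subset n → Subset m) → Subset m → Bool
image g v = any (λ S → ⌊ v ≟ˢ g S ⌋)

image-∋ : ∀ {n m} (g : Subset n → Subset m) S → T (image g (g S))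
image-∋ g S = any-intro (λ S′ → ⌊ g S ≟ˢ g S′ ⌋) S (fromWitness refl)

image-∀ : ∀ {n m} {P : Subset m → Set} (g : Subset n → Subset m) → (∀ S → P (g S)) → ∀ {v} → T (image g v) → P v
image-∀ {P = P} g P∘g {v} t =
  let S , v≡gS = any-elim (λ S → ⌊ v ≟ˢ g S ⌋) t in subst P (sym (toWitness v≡gS)) (P∘g S)

XorCovering : ∀ {m} → (Subset m → Bool) → Set
XorCovering f = ∀ S → ∃ λ a → T (f a) × T (f (a ⊕ S))

xorCovering⇒2^m≤count*count : ∀ {m} (f : Subset m → Bool) → XorCovering f → 2 ^ m ≤ count f * count f
xorCovering⇒2^m≤count*count {m} f covering = begin
  2 ^ m                                                ≡⟨ count-true {m} ⟨
  count {m} (λ _ → true)                               ≤⟨ count-mono {m} covered ⟩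
  count (λ S → any (λ a → f a ∧ f (a ⊕ S)))            ≤⟨ count-any (λ a S → f a ∧ f (a ⊕ S)) ⟩
  sum (λ a → count (λ S → f a ∧ f (a ⊕ S)))            ≡⟨ sum-cong (λ a → count-∧ˡ (f a) (f ∘ (a ⊕_))) ⟩
  sum (λ a → iverson (f a) * count (λ S → f (a ⊕ S)))  ≡⟨ sum-cong (λ a → cong (iverson (f a) *_) (sum-⊕ (iverson ∘ f) a)) ⟩
  sum (λ a → iverson (f a) * count f)                  ≡⟨ sum-*ʳ (iverson ∘ f) (count f) ⟨
  count f * count f                                    ∎
  where
  open ≤-Reasoning
  covered : ∀ {S} → T true → T (any (λ a → f a ∧ f (a ⊕ S)))
  covered {S} _ =
    let a , fa , fa⊕S = covering S in any-intro (λ a → f a ∧ f (a ⊕ S)) a (from T-∧ (fa , fa⊕S))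

image∪image-xorCovering : ∀ {m} (g₁ g₂ : Subset m → Subset m) → (∀ S → g₁ S ⊕ S ≡ g₂ S) →
                          XorCovering (λ v → image g₁ v ∨ image g₂ v)
image∪image-xorCovering g₁ g₂ g₁⊕≡g₂ S =
  g₁ S , from T-∨ (inj₁ (image-∋ g₁ S)) ,
  subst (λ v → T (image g₁ v ∨ image g₂ v)) (sym (g₁⊕≡g₂ S)) (from T-∨ (inj₂ (image-∋ g₂ S)))

-- The Sauer–Shelah lemma

Shattersᵇ : ∀ {m} → (Subset m → Bool) → Subset m → Set
Shattersᵇ f S = ∀ R → ∃ λ v → T (f v) × (∀ {i} → i ∈ S → lookup v i ≡ lookup R i)

shattersᵇ-⊥ : ∀ {m} {f : Subset m → Bool} {v} → T (f v) → Shattersᵇ f ⊥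
shattersᵇ-⊥ {v = v} fv R = v , fv , λ i∈⊥ → contradiction i∈⊥ ∉⊥

shattersᵇ-∨ : ∀ {m} {f : Subset (suc m) → Bool} {S} →
  Shattersᵇ (λ v → f (false ∷ v) ∨ f (true ∷ v)) S → Shattersᵇ f (false ∷ S)
shattersᵇ-∨ {f = f} sh (r ∷ R) with sh R
... | v , f₀∨f₁ , agree with to T-∨ f₀∨f₁
...   | inj₁ f₀ = false ∷ v , f₀ , λ { (there i∈S) → agree i∈S }
...   | inj₂ f₁ = true ∷ v , f₁ , λ { (there i∈S) → agree i∈S }

shattersᵇ-∧ : ∀ {m} {f : Subset (suc m) → Bool} {S} →
  Shattersᵇ (λ v → f (false ∷ v) ∧ f (true ∷ v)) S → Shattersᵇ f (true ∷ S)
shattersᵇ-∧ {f = f} sh (r ∷ R) with sh R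
... | v , f₀∧f₁ , agree = r ∷ v , both r (to T-∧ f₀∧f₁) , λ { here → refl ; (there i∈S) → agree i∈S }
  where
  both : ∀ r → T (f (false ∷ v)) × T (f (true ∷ v)) → T (f (r ∷ v))
  both false = proj₁
  both true  = proj₂

-- Φ m k = Σ_{i<k} (m choose i), the number of subsets of size < k of an m-set.
Φ : ℕ → ℕ → ℕ
Φ m       zero    = 0
Φ zero    (suc k) = 1
Φ (suc m) (suc k) = Φ m (suc k) + Φ m k

sauer-shelah : ∀ m k (f : Subset m → Bool) → (∀ {S} → Shattersᵇ f S → ∣ S ∣ < k) → count f ≤ Φ m k
sauer-shelah m zero f small = ≤-trans (count-mono {m} λ fv → contradiction (small (shattersᵇ-⊥ fv)) n≮0)
                                       (≤-reflexive (count-false {m}))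
sauer-shelah zero (suc k) f small = iverson≤1 (f [])
sauer-shelah (suc m) (suc k) f small = begin
  count f₀ + count f₁                                     ≡⟨ count-∨+count-∧ f₀ f₁ ⟩
  count (λ v → f₀ v ∨ f₁ v) + count (λ v → f₀ v ∧ f₁ v)   ≤⟨ +-mono-≤ (sauer-shelah m (suc k) _ (small ∘ shattersᵇ-∨))
                                                                      (sauer-shelah m k _ (s<s⁻¹ ∘ small ∘ shattersᵇ-∧)) ⟩
  Φ m (suc k) + Φ m k                                     ∎
  where
  open ≤-Reasoning
  f₀ f₁ : Subset m → Bool
  f₀ v = f (false ∷ v)
  f₁ v = f (true ∷ v)

-- Traces on a finite subset of X

select : ∀ {m} (S : Subset m) → Fin ∣ S ∣ → Fin m
select (true ∷ S)  zero    = zero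
select (true ∷ S)  (suc j) = suc (select S j)
select (false ∷ S) j       = suc (select S j)

select-injective : ∀ {m} (S : Subset m) {i j} → select S i ≡ select S j → i ≡ j
select-injective (true ∷ S)  {zero}  {zero}  _ = refl
select-injective (true ∷ S)  {suc i} {suc j} p = cong suc (select-injective S (fsuc-injective p))
select-injective (false ∷ S)                 p = select-injective S (fsuc-injective p)

select-∈ : ∀ {m} (S : Subset m) j → select S j ∈ S
select-∈ (true ∷ S)  zero    = here
select-∈ (true ∷ S)  (suc j) = there (select-∈ S j)
select-∈ (false ∷ S) j       = there (select-∈ S j)

spread : ∀ {m} (S : Subset m) → Subset ∣ S ∣ → Subset m
spread []          []      = []
spread (true ∷ S)  (r ∷ R) = r ∷ spread S R
spread (false ∷ S) R       = false ∷ spread S R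

lookup-spread : ∀ {m} (S : Subset m) R j → lookup (spread S R) (select S j) ≡ lookup R j
lookup-spread (true ∷ S)  (r ∷ R) zero    = refl
lookup-spread (true ∷ S)  (r ∷ R) (suc j) = lookup-spread S R j
lookup-spread (false ∷ S) R       j       = lookup-spread S R j

module _ {X : Set} {m} (U : FinSub X m) where

  restrict : (S : Subset m) → FinSub X ∣ S ∣
  restrict S = record { elt = elt U ∘ select S ; inj = select-injective S ∘ inj U }

  trace : Pow X → Subset m
  trace H = tabulate (λ i → H (elt U i))

  IsTrace : Family X → Subset m → Set
  IsTrace 𝓗 v = ∃ λ H → 𝓗 H × trace H ≡ v

  shattered-traces-≤ : ∀ {𝓗 d} → VC≤ 𝓗 d → (f : Subset m → Bool) → (∀ {v} → T (f v) → IsTrace 𝓗 v) →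
                       ∀ {S} → Shattersᵇ f S → ∣ S ∣ ≤ d
  shattered-traces-≤ {𝓗} vc f traces {S} sh = vc (restrict S) shatters
    where
    shatters : Shatters 𝓗 (restrict S)
    shatters R with sh (spread S R)
    ... | v , fv , agree with traces fv
    ...   | H , H∈𝓗 , refl = H , H∈𝓗 , λ j → begin
      H (elt U (select S j))             ≡⟨ lookup∘tabulate (λ i → H (elt U i)) (select S j) ⟨
      lookup (trace H) (select S j)      ≡⟨ agree (select-∈ S j) ⟩
      lookup (spread S R) (select S j)   ≡⟨ lookup-spread S R j ⟩
      lookup R j                         ∎
      where open ≡-Reasoning

  record ⊕-Split (𝓗 : Family X) (S : Subset m) : Set where
    field
      H₁ H₂   : Pow X
      H₁∈𝓗    : 𝓗 H₁
      H₂∈𝓗    : 𝓗 H₂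
      trace-⊕ : trace H₁ ⊕ S ≡ trace H₂

  △-shatters⇒⊕-split : ∀ {𝓗} → Shatters (SymDiffFamily 𝓗) U → ∀ S → ⊕-Split 𝓗 S
  △-shatters⇒⊕-split sh S with sh S
  ... | _ , (H₁ , H₂ , H₁∈𝓗 , H₂∈𝓗 , refl) , G∩U≡S = record
    { H₁ = H₁ ; H₂ = H₂ ; H₁∈𝓗 = H₁∈𝓗 ; H₂∈𝓗 = H₂∈𝓗
    ; trace-⊕ = trans (sym (tabulate∘lookup _)) (tabulate-cong pointwise)
    }
    where
    open ≡-Reasoning
    pointwise : ∀ i → lookup (trace H₁ ⊕ S) i ≡ H₂ (elt U i)
    pointwise i = let x = H₁ (elt U i); y = H₂ (elt U i) in begin
      lookup (trace H₁ ⊕ S) i             ≡⟨ lookup-zipWith _xor_ i (trace H₁) S ⟩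
      lookup (trace H₁) i xor lookup S i  ≡⟨ cong₂ _xor_ (lookup∘tabulate _ i) (sym (G∩U≡S i)) ⟩
      x xor (x xor y)                     ≡⟨ xor-assoc x x y ⟨
      (x xor x) xor y                     ≡⟨ cong (_xor y) (xor-same x) ⟩
      y                                   ∎

  record TraceCover (𝓗 : Family X) : Set where
    field
      members  : Subset m → Bool
      traces   : ∀ {v} → T (members v) → IsTrace 𝓗 v
      covering : XorCovering members

-- Only the traces of the chosen H₁ S, H₂ S are collected: they form a decidable, hence countable,
-- family, whereas the set of all traces of 𝓗 on U need not be decidable.
△-shatters⇒traceCover : ∀ {X} {𝓗 : Family X} {m} (U : FinSub X m) →
                        Shatters (SymDiffFamily 𝓗) U → TraceCover U 𝓗
△-shatters⇒traceCover {𝓗 = 𝓗} U sh = record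
  { members  = λ v → image (trace U ∘ H₁) v ∨ image (trace U ∘ H₂) v
  ; traces   = λ {v} → [ image-∀ {P = IsTrace U 𝓗} (trace U ∘ H₁) (λ S → H₁ S , H₁∈𝓗 S , refl)
                       , image-∀ {P = IsTrace U 𝓗} (trace U ∘ H₂) (λ S → H₂ S , H₂∈𝓗 S , refl) ]′ ∘ to T-∨
  ; covering = image∪image-xorCovering (trace U ∘ H₁) (trace U ∘ H₂) trace-⊕
  }
  where open module Split S = ⊕-Split (△-shatters⇒⊕-split U sh S)

-- The entropy estimate

Φ-1 : ∀ m → Φ m 1 ≡ 1
Φ-1 zero    = refl
Φ-1 (suc m) = trans (+-identityʳ (Φ m 1)) (Φ-1 m)

-- Σ_{i≤d} (m choose i) aᵈ bᵐ⁻ᵈ ≤ Σ_{i≤d} (m choose i) aⁱ bᵐ⁻ⁱ ≤ (a + b)ᵐ, multiplied by bᵈ to avoid subtraction.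
Φ*a^d*b^m≤[a+b]^m*b^d : ∀ m d {a b} → a ≤ b → Φ m (suc d) * a ^ d * b ^ m ≤ (a + b) ^ m * b ^ d
Φ*a^d*b^m≤[a+b]^m*b^d m zero {a} {b} _ = begin
  Φ m 1 * 1 * b ^ m   ≡⟨ cong (λ c → c * 1 * b ^ m) (Φ-1 m) ⟩
  1 * 1 * b ^ m       ≡⟨ *-identityˡ (b ^ m) ⟩
  b ^ m               ≤⟨ ^-monoˡ-≤ m (m≤n+m b a) ⟩
  (a + b) ^ m         ≡⟨ *-identityʳ _ ⟨
  (a + b) ^ m * 1     ∎
  where open ≤-Reasoning
Φ*a^d*b^m≤[a+b]^m*b^d zero (suc d) {a} {b} a≤b = begin
  1 * a ^ suc d * 1   ≡⟨ trans (*-identityʳ _) (*-identityˡ _) ⟩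
  a ^ suc d           ≤⟨ ^-monoˡ-≤ (suc d) a≤b ⟩
  b ^ suc d           ≡⟨ *-identityˡ _ ⟨
  1 * b ^ suc d       ∎
  where open ≤-Reasoning
Φ*a^d*b^m≤[a+b]^m*b^d (suc m) (suc d) {a} {b} a≤b = begin
  (Φ m (2 + d) + Φ m (1 + d)) * (a * a ^ d) * (b * b ^ m)
    ≡⟨ split (Φ m (2 + d)) (Φ m (1 + d)) a b (a ^ d) (b ^ m) ⟩
  Φ m (2 + d) * a ^ suc d * b ^ m * b + Φ m (1 + d) * a ^ d * b ^ m * (a * b)
    ≤⟨ +-mono-≤ (*-monoˡ-≤ b (Φ*a^d*b^m≤[a+b]^m*b^d m (suc d) a≤b))
                (*-monoˡ-≤ (a * b) (Φ*a^d*b^m≤[a+b]^m*b^d m d a≤b)) ⟩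
  (a + b) ^ m * b ^ suc d * b + (a + b) ^ m * b ^ d * (a * b)
    ≡⟨ merge ((a + b) ^ m) a b (b ^ d) ⟩
  (a + b) * (a + b) ^ m * (b * b ^ d)
    ∎
  where
  open ≤-Reasoning
  split : ∀ x y a b p q → (x + y) * (a * p) * (b * q) ≡ x * (a * p) * q * b + y * p * q * (a * b)
  split = solve-∀
  merge : ∀ z a b p → z * (b * p) * b + z * p * (a * b) ≡ (a + b) * z * (b * p)
  merge = solve-∀

Φ*d^d*[m∸d]^[m∸d]≤m^m : ∀ {m d} → 2 * d < m → Φ m (suc d) * (d ^ d * (m ∸ d) ^ (m ∸ d)) ≤ m ^ m
Φ*d^d*[m∸d]^[m∸d]≤m^m {m} {d} 2d<m = *-cancelʳ-≤ _ _ (e ^ d) (begin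
  Φ m (suc d) * (d ^ d * e ^ e) * e ^ d   ≡⟨ cong (_* e ^ d) (*-assoc (Φ m (suc d)) (d ^ d) (e ^ e)) ⟨
  Φ m (suc d) * d ^ d * e ^ e * e ^ d     ≡⟨ *-assoc (Φ m (suc d) * d ^ d) (e ^ e) (e ^ d) ⟩
  Φ m (suc d) * d ^ d * (e ^ e * e ^ d)   ≡⟨ cong (Φ m (suc d) * d ^ d *_) (^-distribˡ-+-* e e d) ⟨
  Φ m (suc d) * d ^ d * e ^ (e + d)       ≡⟨ cong (λ n → Φ m (suc d) * d ^ d * e ^ n) (m∸n+n≡m d≤m) ⟩
  Φ m (suc d) * d ^ d * e ^ m             ≤⟨ Φ*a^d*b^m≤[a+b]^m*b^d m d (<⇒≤ d<e) ⟩
  (d + e) ^ m * e ^ d                     ≡⟨ cong (λ n → n ^ m * e ^ d) (m+[n∸m]≡n d≤m) ⟩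
  m ^ m * e ^ d                           ∎)
  where
  open ≤-Reasoning
  e : ℕ
  e = m ∸ d
  d+d<m : d + d < m
  d+d<m = subst (_< m) (cong (d +_) (+-identityʳ d)) 2d<m
  d<e : d < e
  d<e = m+n≤o⇒m≤o∸n (suc d) d+d<m
  d≤m : d ≤ m
  d≤m = ≤-trans (m≤m+n d d) (<⇒≤ d+d<m)
  instance
    e^d≢0 : NonZero (e ^ d)
    e^d≢0 = m^n≢0 e d {{>-nonZero (≤-<-trans z≤n d<e)}}

^-double : ∀ x n → x ^ (2 * n) ≡ x ^ n * x ^ n
^-double x n = trans (cong (λ k → x ^ (n + k)) (+-identityʳ n)) (^-distribˡ-+-* x n n)

2^m≤Φ*Φ⇒LeC : ∀ {m d} → 2 ^ m ≤ Φ m (suc d) * Φ m (suc d) → LeC m d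
2^m≤Φ*Φ⇒LeC {m} {d} 2^m≤Φ*Φ with m ≤? 2 * d
... | yes m≤2d = inj₁ m≤2d
... | no  m≰2d = inj₂ (begin
  2 ^ m * d ^ (2 * d) * e ^ (2 * e)                        ≡⟨ cong₂ (λ x y → 2 ^ m * x * y) (^-double d d) (^-double e e) ⟩
  2 ^ m * (d ^ d * d ^ d) * (e ^ e * e ^ e)                ≤⟨ *-monoˡ-≤ (e ^ e * e ^ e) (*-monoˡ-≤ (d ^ d * d ^ d) 2^m≤Φ*Φ) ⟩
  Φ m (suc d) * Φ m (suc d) * (d ^ d * d ^ d) * (e ^ e * e ^ e)  ≡⟨ regroup (Φ m (suc d)) (d ^ d) (e ^ e) ⟩
  Φ m (suc d) * (d ^ d * e ^ e) * (Φ m (suc d) * (d ^ d * e ^ e))  ≤⟨ *-mono-≤ entropy entropy ⟩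
  m ^ m * m ^ m                                            ≡⟨ ^-double m m ⟨
  m ^ (2 * m)                                              ∎)
  where
  open ≤-Reasoning
  e : ℕ
  e = m ∸ d
  entropy : Φ m (suc d) * (d ^ d * e ^ e) ≤ m ^ m
  entropy = Φ*d^d*[m∸d]^[m∸d]≤m^m (≰⇒> m≰2d)
  regroup : ∀ c x y → c * c * (x * x) * (y * y) ≡ c * (x * y) * (c * (x * y))
  regroup = solve-∀

lemmaA5 : {X : Set} (𝓗 : Family X) (d : ℕ) → VC≤ 𝓗 d →
    ∀ {m} (U : FinSub X m) → Shatters (SymDiffFamily 𝓗) U → LeC m d
lemmaA5 𝓗 d vc {m} U sh = 2^m≤Φ*Φ⇒LeC (begin
  2 ^ m                          ≤⟨ xorCovering⇒2^m≤count*count members covering ⟩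
  count members * count members  ≤⟨ *-mono-≤ count≤Φ count≤Φ ⟩
  Φ m (suc d) * Φ m (suc d)      ∎)
  where
  open ≤-Reasoning
  open TraceCover (△-shatters⇒traceCover U sh)
  count≤Φ : count members ≤ Φ m (suc d)
  count≤Φ = sauer-shelah m (suc d) members (s≤s ∘ shattered-traces-≤ U vc members traces)
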